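{- Let $P$ be an infinite edge-periodic path, let $L=\{l_e: e\in E(P)\}$, and assume $|L|$ is finite; let $\mathsf{LCM}$ denote the least common multiple of $L$. Consider the cop-and-robber game on $P$ started at an arbitrary time step $t$ (the cop chooses a start vertex $c_t$, then the robber chooses a start vertex, and moves then proceed in time steps $t,t+1,\dots$). If $\mathsf{LCM}=\max L$, then the robber has a winning strategy from any start vertex at distance at least $2\cdot\mathsf{LCM}$ from $c_t$; otherwise the robber has a winning strategy from any start vertex at distance at least $\mathsf{LCM}$ from $c_t$.
   Context: An edge-periodic graph has an underlying simple graph and time steps $0,1,2,\dots$; each edge $e$ carries a bit pattern $b_e(0)\cdots b_e(l_e-1)$ of length $l_e\ge1$ containing at least one $1$, and $e$ is present in time step $s$ iff $b_e(s\bmod l_e)=1$. An infinite edge-periodic path is such a graph whose underlying graph is an infinite path. Game: the cop chooses a start vertex, then the robber (knowing it) chooses one; in each time step, first the cop then the robber moves, each either staying at its current vertex or traversing an incident edge present in that time step, with full information. The cop wins as soon as both occupy the same vertex at the end of a move; the robber wins (has a winning strategy) if it can avoid this forever. -}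

module Defs where

open import Data.Nat using (ℕ; zero; suc; _≤_; _<_; _*_; NonZero)
open import Data.Nat.DivMod using (_mod_)
open import Data.Nat.Divisibility using (_∣_)
open import Data.Integer using (ℤ; _+_; _-_; ∣_∣; 1ℤ)
open import Data.Fin using (Fin; toℕ)
open import Data.Vec using (Vec; tabulate)
open import Data.Nat renaming (_+_ to _+ℕ_) using ()
open import Data.Bool using (Bool; true)
open import Data.List using (List)
open import Data.List.Membership.Propositional using (_∈_)
open import Data.Product using (Σ; _×_; ∃)
open import Data.Sum using (_⊎_)
open import Relation.Binary.PropositionalEquality using (_≡_; _≢_)

-- An infinite (two-way) edge-periodic path: vertices are the integers,
-- edge i joins vertex i and vertex i + 1.
record EPPath : Set where
  field
    len     : ℤ → ℕ
    len-nz  : (i : ℤ) → NonZero (len i)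
    pat     : (i : ℤ) → Fin (len i) → Bool
    has-one : (i : ℤ) → ∃ λ j → pat i j ≡ true

  Present : ℤ → ℕ → Set
  Present i s = pat i (_mod_ s (len i) {{len-nz i}}) ≡ true

open EPPath public

Move : EPPath → ℕ → ℤ → ℤ → Set
Move G s u v =
  (v ≡ u) ⊎ ((v ≡ u + 1ℤ) × Present G u s) ⊎ ((u ≡ v + 1ℤ) × Present G v s)

FiniteLengths : EPPath → Set
FiniteLengths G = Σ (List ℕ) λ Ls → (i : ℤ) → len G i ∈ Ls

IsLCMOf : EPPath → ℕ → Set
IsLCMOf G m =
  ((i : ℤ) → len G i ∣ m) × (0 < m)
  × ((n : ℕ) → 0 < n → ((i : ℤ) → len G i ∣ n) → m ≤ n)

IsMaxOf : EPPath → ℕ → Set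
IsMaxOf G M = ((i : ℤ) → len G i ≤ M) × ∃ λ i → len G i ≡ M

-- A robber strategy: after the cop's move in the k-th step of the game
-- (time step t + k), the robber sees the whole history of cop positions
-- c_0, c_1, ..., c_{k+1} (full information; its own past positions are
-- determined by these) and chooses its new position r_{k+1}.
RobberStrategy : Set
RobberStrategy = (k : ℕ) → Vec ℤ (suc (suc k)) → ℤ

prefix : (ℕ → ℤ) → (n : ℕ) → Vec ℤ n
prefix cs n = tabulate (λ j → cs (toℕ j))

robberPos : RobberStrategy → ℤ → (ℕ → ℤ) → ℕ → ℤ
robberPos σ r cs zero    = r
robberPos σ r cs (suc k) = σ k (prefix cs (suc (suc k)))

LegalCop : EPPath → ℕ → ℤ → (ℕ → ℤ) → Set
LegalCop G t c cs = (cs 0 ≡ c) × ((k : ℕ) → Move G (t +ℕ k) (cs k) (cs (suc k)))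

IsWinningRobber : EPPath → ℕ → ℤ → ℤ → RobberStrategy → Set
IsWinningRobber G t c r σ =
  (c ≢ r) ×
  ((cs : ℕ → ℤ) → LegalCop G t c cs → (k : ℕ) →
     Move G (t +ℕ k) (robberPos σ r cs k) (robberPos σ r cs (suc k))
     × (cs (suc k) ≢ robberPos σ r cs k)
     × (cs (suc k) ≢ robberPos σ r cs (suc k)))

RobberWins : EPPath → ℕ → ℤ → ℤ → Set
RobberWins G t c r = Σ RobberStrategy λ σ → IsWinningRobber G t c r σ

dist : ℤ → ℤ → ℕ
dist c r = ∣ c - r ∣

module Submission where

-- Let P be a common multiple of all edge periods that is strictly
-- larger than every period, and let the robber start at distance ≥ P from the
-- cop, say to the right (the other side follows by reflecting the path).  The
-- robber ignores the cop and runs GREEDILY to the right: in every time step it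
-- crosses the edge to its right whenever that edge is present.
--   * Every edge is present at least once in any window of (its period) < P
--     consecutive steps, so the greedy walk advances within fewer than P steps.
--   * The presence pattern is P-periodic, so the greedy walk started at time t
--     and the one started at time t + P coincide.
--   * A greedy walk dominates every walk that starts at or to its left.
-- During the first P steps the cop, moving at speed ≤ 1, cannot reach the
-- robber's start.  Afterwards the cop's position P steps later is dominated by
-- the greedy walk (which it started behind), while the robber has meanwhile
-- advanced by at least one more vertex; so the cop always stays strictly left.
-- Finally P = 2·LCM works when LCM = max L, and P = LCM works otherwise.

open import Defs
open import Data.Nat using (ℕ; _≤_; _*_)
open import Data.Integer using (ℤ)
open import Data.Product using (_×_)
open import Relation.Binary.PropositionalEquality using (_≡_; _≢_)

open import Data.Nat using (zero; suc; _<_; _∸_; NonZero; >-nonZero; z≤n; _≤?_; _≤′_; ≤′-refl; ≤′-step)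
  renaming (_+_ to _+ℕ_)
import Data.Nat.Properties as ℕ
open import Data.Nat.DivMod using (_%_; _/_; _mod_; %-distribˡ-+; m%n%n≡m%n; m%n<n; m%n≤n; m≡m%n+[m/n]*n; [m+kn]%n≡m%n; m<n⇒m%n≡m; %-remove-+ʳ)
open import Data.Nat.Divisibility using (_∣_; ∣⇒≤; ∣-trans; n∣m*n)
open import Data.Integer using (+_; -_; _+_; _-_; 1ℤ; ∣_∣; +≤+; +<+; _≟_)
  renaming (_≤_ to _≤ᶻ_; _<_ to _<ᶻ_)
import Data.Integer.Properties as ℤ
open import Data.Integer.Tactic.RingSolver using (solve-∀)
open import Data.Bool using (Bool; true; false; if_then_else_)
open import Data.Fin using (toℕ)
import Data.Fin.Properties as Fin
open import Data.Product using (∃; _,_; proj₁; proj₂)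
open import Data.Sum using (inj₁; inj₂)
open import Relation.Nullary using (yes; no)
open import Relation.Binary.PropositionalEquality using (refl; sym; trans; cong; subst; module ≡-Reasoning)

%-absorbʳ : ∀ m n l .{{_ : NonZero l}} → (m +ℕ n % l) % l ≡ (m +ℕ n) % l
%-absorbʳ m n l = begin
  (m +ℕ n % l) % l          ≡⟨ %-distribˡ-+ m (n % l) l ⟩
  (m % l +ℕ n % l % l) % l  ≡⟨ cong (λ z → (m % l +ℕ z) % l) (m%n%n≡m%n n l) ⟩
  (m % l +ℕ n % l) % l      ≡⟨ %-distribˡ-+ m n l ⟨
  (m +ℕ n) % l              ∎
  where open ≡-Reasoning

residue-within : ∀ l .{{_ : NonZero l}} (s x : ℕ) → x < l →
                 ∃ λ u → u < l × (s +ℕ u) % l ≡ x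
residue-within l s x x<l = w % l , m%n<n w l , hit
  where
  open ≡-Reasoning
  ρ q w : ℕ
  ρ = s % l
  q = s / l
  w = (l ∸ ρ) +ℕ x
  to-multiple : s +ℕ (l ∸ ρ) ≡ suc q * l
  to-multiple = begin
    s +ℕ (l ∸ ρ)             ≡⟨ cong (_+ℕ (l ∸ ρ)) (trans (m≡m%n+[m/n]*n s l) (ℕ.+-comm ρ (q * l))) ⟩
    q * l +ℕ ρ +ℕ (l ∸ ρ)    ≡⟨ ℕ.+-assoc (q * l) ρ (l ∸ ρ) ⟩
    q * l +ℕ (ρ +ℕ (l ∸ ρ))  ≡⟨ cong (q * l +ℕ_) (ℕ.m+[n∸m]≡n (m%n≤n s l)) ⟩
    q * l +ℕ l               ≡⟨ ℕ.+-comm (q * l) l ⟩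
    suc q * l                ∎
  hit : (s +ℕ w % l) % l ≡ x
  hit = begin
    (s +ℕ w % l) % l            ≡⟨ %-absorbʳ s w l ⟩
    (s +ℕ ((l ∸ ρ) +ℕ x)) % l   ≡⟨ cong (_% l) (sym (ℕ.+-assoc s (l ∸ ρ) x)) ⟩
    (s +ℕ (l ∸ ρ) +ℕ x) % l     ≡⟨ cong (λ z → (z +ℕ x) % l) to-multiple ⟩
    (suc q * l +ℕ x) % l        ≡⟨ cong (_% l) (ℕ.+-comm (suc q * l) x) ⟩
    (x +ℕ suc q * l) % l        ≡⟨ [m+kn]%n≡m%n x (suc q) l ⟩
    x % l                       ≡⟨ m<n⇒m%n≡m x<l ⟩
    x                           ∎

present? : EPPath → ℤ → ℕ → Bool
present? G i s = pat G i (_mod_ s (len G i) {{len-nz G i}})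

edge-window : (G : EPPath) (i : ℤ) (s : ℕ) → ∃ λ u → u < len G i × Present G i (s +ℕ u)
edge-window G i s with has-one G i
... | j , bit-j with residue-within (len G i) {{len-nz G i}} s (toℕ j) (Fin.toℕ<n j)
... | u , u<l , hit = u , u<l , subst (λ k → pat G i k ≡ true) (sym hits-j) bit-j
  where
  hits-j : _mod_ (s +ℕ u) (len G i) {{len-nz G i}} ≡ j
  hits-j = Fin.toℕ-injective (trans (Fin.toℕ-fromℕ< _) hit)

present-periodic : (G : EPPath) (P : ℕ) → (∀ i → len G i ∣ P) →
                   ∀ i s → present? G i (s +ℕ P) ≡ present? G i s
present-periodic G P divides-P i s =
  cong (pat G i) (Fin.toℕ-injective (trans (Fin.toℕ-fromℕ< _)
    (trans (%-remove-+ʳ s {{len-nz G i}} (divides-P i)) (sym (Fin.toℕ-fromℕ< _)))))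

Walk : EPPath → ℕ → (ℕ → ℤ) → Set
Walk G s a = (k : ℕ) → Move G (s +ℕ k) (a k) (a (suc k))

walk-shift : (G : EPPath) (s P : ℕ) (a : ℕ → ℤ) → Walk G s a → Walk G (s +ℕ P) (λ k → a (P +ℕ k))
walk-shift G s P a walk k rewrite ℕ.+-assoc s P k | ℕ.+-suc P k = walk (P +ℕ k)

move-right-bound : ∀ G s u v → Move G s u v → v ≤ᶻ u + 1ℤ
move-right-bound G s u v (inj₁ refl) = ℤ.i≤i+j u 1ℤ
move-right-bound G s u v (inj₂ (inj₁ (refl , _))) = ℤ.≤-refl
move-right-bound G s u v (inj₂ (inj₂ (refl , _))) = ℤ.≤-trans (ℤ.i≤i+j v 1ℤ) (ℤ.i≤i+j (v + 1ℤ) 1ℤ)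

walk-speed : (G : EPPath) (s : ℕ) (a : ℕ → ℤ) → Walk G s a → ∀ k → a k ≤ᶻ a 0 + + k
walk-speed G s a walk zero = ℤ.≤-reflexive (sym (ℤ.+-identityʳ (a 0)))
walk-speed G s a walk (suc k) = begin
  a (suc k)           ≤⟨ move-right-bound G _ _ _ (walk k) ⟩
  a k + 1ℤ            ≤⟨ ℤ.+-monoˡ-≤ 1ℤ (walk-speed G s a walk k) ⟩
  a 0 + + k + 1ℤ      ≡⟨ ℤ.+-assoc (a 0) (+ k) 1ℤ ⟩
  a 0 + (+ k + 1ℤ)    ≡⟨ cong (λ n → a 0 + n) (trans (sym (ℤ.pos-+ k 1)) (cong +_ (ℕ.+-comm k 1))) ⟩
  a 0 + + suc k       ∎
  where open ℤ.≤-Reasoning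

nondecreasing : (f : ℕ → ℤ) → (∀ k → f k ≤ᶻ f (suc k)) → ∀ {j k} → j ≤ k → f j ≤ᶻ f k
nondecreasing f up j≤k = go (ℕ.≤⇒≤′ j≤k)
  where
  go : ∀ {j k} → j ≤′ k → f j ≤ᶻ f k
  go ≤′-refl = ℤ.≤-refl
  go (≤′-step j≤′k) = ℤ.≤-trans (go j≤′k) (up _)

greedy-step : EPPath → ℕ → ℤ → ℤ
greedy-step G s v = if present? G v s then v + 1ℤ else v

greedy-step-present : ∀ G s v → Present G v s → greedy-step G s v ≡ v + 1ℤ
greedy-step-present G s v present rewrite present = refl

greedy-step-≥ : ∀ G s v → v ≤ᶻ greedy-step G s v
greedy-step-≥ G s v with present? G v s
... | true = ℤ.i≤i+j v 1ℤ
... | false = ℤ.≤-refl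

greedy-step-legal : ∀ G s v → Move G s v (greedy-step G s v)
greedy-step-legal G s v with present? G v s
... | true = inj₂ (inj₁ (refl , refl))
... | false = inj₁ refl

greedy-step-dominates : ∀ G s u v w → Move G s u v → u ≤ᶻ w → v ≤ᶻ greedy-step G s w
greedy-step-dominates G s u v w (inj₁ refl) u≤w = ℤ.≤-trans u≤w (greedy-step-≥ G s w)
greedy-step-dominates G s u v w (inj₂ (inj₂ (refl , _))) u≤w =
  ℤ.≤-trans (ℤ.i≤i+j v 1ℤ) (ℤ.≤-trans u≤w (greedy-step-≥ G s w))
greedy-step-dominates G s u v w (inj₂ (inj₁ (refl , present))) u≤w with u ≟ w
... | yes refl = ℤ.≤-reflexive (sym (greedy-step-present G s u present))
... | no u≢w = ℤ.≤-trans u+1≤w (greedy-step-≥ G s w)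
  where
  u+1≤w : u + 1ℤ ≤ᶻ w
  u+1≤w = subst (_≤ᶻ w) (ℤ.+-comm 1ℤ u) (ℤ.i<j⇒suc[i]≤j (ℤ.≤∧≢⇒< u≤w u≢w))

greedy-walk : EPPath → ℕ → ℤ → ℕ → ℤ
greedy-walk G s x zero = x
greedy-walk G s x (suc k) = greedy-step G (s +ℕ k) (greedy-walk G s x k)

greedy-walk-legal : ∀ G s x → Walk G s (greedy-walk G s x)
greedy-walk-legal G s x k = greedy-step-legal G (s +ℕ k) (greedy-walk G s x k)

greedy-walk-monotone : ∀ G s x {j k} → j ≤ k → greedy-walk G s x j ≤ᶻ greedy-walk G s x k
greedy-walk-monotone G s x =
  nondecreasing (greedy-walk G s x) (λ k → greedy-step-≥ G (s +ℕ k) (greedy-walk G s x k))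

greedy-walk-dominates : (G : EPPath) (s : ℕ) (x : ℤ) (a : ℕ → ℤ) → Walk G s a → a 0 ≤ᶻ x →
                        ∀ k → a k ≤ᶻ greedy-walk G s x k
greedy-walk-dominates G s x a walk a0≤x zero = a0≤x
greedy-walk-dominates G s x a walk a0≤x (suc k) =
  greedy-step-dominates G _ _ _ _ (walk k) (greedy-walk-dominates G s x a walk a0≤x k)

greedy-walk-periodic : (G : EPPath) (P : ℕ) → (∀ i → len G i ∣ P) →
                       ∀ s x k → greedy-walk G (s +ℕ P) x k ≡ greedy-walk G s x k
greedy-walk-periodic G P divides-P s x zero = refl
greedy-walk-periodic G P divides-P s x (suc k)
  rewrite greedy-walk-periodic G P divides-P s x k
        | ℕ.+-assoc s P k | ℕ.+-comm P k | sym (ℕ.+-assoc s k P) =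
  cong (λ b → if b then g + 1ℤ else g) (present-periodic G P divides-P g (s +ℕ k))
  where
  g : ℤ
  g = greedy-walk G s x k

greedy-walk-advances : ∀ G s x j → ∃ λ u → u < len G (greedy-walk G s x j) ×
                       greedy-walk G s x j <ᶻ greedy-walk G s x (suc u +ℕ j)
greedy-walk-advances G s x j with edge-window G (greedy-walk G s x j) (s +ℕ j)
... | u , u<l , present = u , u<l , ℤ.suc[i]≤j⇒i<j (subst (_≤ᶻ g (suc u +ℕ j)) (ℤ.+-comm (g j) 1ℤ) advance)
  where
  g : ℕ → ℤ
  g = greedy-walk G s x
  cross : Move G (s +ℕ (u +ℕ j)) (g j) (g j + 1ℤ)
  cross = inj₂ (inj₁ (refl , subst (Present G (g j)) same-time present))
    where
    same-time : s +ℕ j +ℕ u ≡ s +ℕ (u +ℕ j)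
    same-time = trans (ℕ.+-assoc s j u) (cong (s +ℕ_) (ℕ.+-comm j u))
  advance : g j + 1ℤ ≤ᶻ g (suc u +ℕ j)
  advance = greedy-step-dominates G _ _ _ _ cross (greedy-walk-monotone G s x (ℕ.m≤n+m j u))

record Evasion (G : EPPath) (t : ℕ) (c r : ℤ) : Set where
  field
    walk   : ℕ → ℤ
    starts : walk 0 ≡ r
    apart  : c ≢ r
    legal  : Walk G t walk
    evades : (cs : ℕ → ℤ) → LegalCop G t c cs → (k : ℕ) →
             (cs (suc k) ≢ walk k) × (cs (suc k) ≢ walk (suc k))

evasion-wins : ∀ G t c r → Evasion G t c r → RobberWins G t c r
evasion-wins G t c r e = σ , apart , wins
  where
  open Evasion e
  σ : RobberStrategy
  σ k _ = walk (suc k)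
  follows : ∀ cs k → walk k ≡ robberPos σ r cs k
  follows cs zero = starts
  follows cs (suc k) = refl
  wins : ∀ cs → LegalCop G t c cs → ∀ k →
         Move G (t +ℕ k) (robberPos σ r cs k) (robberPos σ r cs (suc k))
         × (cs (suc k) ≢ robberPos σ r cs k) × (cs (suc k) ≢ robberPos σ r cs (suc k))
  wins cs legal-cop k =
    subst (λ p → Move G (t +ℕ k) p (walk (suc k)) × (cs (suc k) ≢ p) × (cs (suc k) ≢ walk (suc k)))
          (follows cs k) (legal k , evades cs legal-cop k)

module EscapeRight (G : EPPath) (P : ℕ) (divides-P : ∀ i → len G i ∣ P) (below-P : ∀ i → len G i < P)
                   (t : ℕ) (c r : ℤ) (far : c + + P ≤ᶻ r) where

  g : ℕ → ℤ
  g = greedy-walk G t r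

  c<r : c <ᶻ r
  c<r = ℤ.<-≤-trans (subst (_<ᶻ c + + P) (ℤ.+-identityʳ c) (ℤ.+-monoʳ-< c (+<+ P>0))) far
    where
    P>0 : 0 < P
    P>0 = ℕ.≤-<-trans z≤n (below-P (+ 0))

  module _ (cs : ℕ → ℤ) (legal-cop : LegalCop G t c cs) where

    cop-walk : Walk G t cs
    cop-walk = proj₂ legal-cop

    cop-speed : ∀ k → cs k ≤ᶻ c + + k
    cop-speed k = subst (λ c₀ → cs k ≤ᶻ c₀ + + k) (proj₁ legal-cop) (walk-speed G t cs cop-walk k)

    -- Before step P the cop cannot even reach the robber's start.
    behind-early : ∀ k → suc k < P → cs (suc k) <ᶻ g k
    behind-early k k+1<P = begin-strict
      cs (suc k)      ≤⟨ cop-speed (suc k) ⟩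
      c + + suc k     <⟨ ℤ.+-monoʳ-< c (+<+ k+1<P) ⟩
      c + + P         ≤⟨ far ⟩
      r               ≤⟨ greedy-walk-monotone G t r {0} {k} z≤n ⟩
      g k             ∎
      where open ℤ.≤-Reasoning

    -- From step P on, the cop is dominated by the greedy walk delayed by P
    -- steps (which by periodicity is the robber's own walk P steps earlier),
    -- and meanwhile the robber has advanced at least once.
    behind-late : ∀ j k → P +ℕ j ≡ suc k → cs (suc k) <ᶻ g k
    behind-late j k P+j≡k+1 with greedy-walk-advances G t r j
    ... | u , u<l , advance = begin-strict
      cs (suc k)                        ≡⟨ cong cs (sym P+j≡k+1) ⟩
      cs (P +ℕ j)                       ≤⟨ trails j ⟩
      greedy-walk G (t +ℕ P) r j        ≡⟨ greedy-walk-periodic G P divides-P t r j ⟩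
      g j                               <⟨ advance ⟩
      g (suc u +ℕ j)                    ≤⟨ greedy-walk-monotone G t r within ⟩
      g k                               ∎
      where
      open ℤ.≤-Reasoning
      cop-start : cs (P +ℕ 0) ≤ᶻ r
      cop-start = subst (λ n → cs n ≤ᶻ r) (sym (ℕ.+-identityʳ P)) (ℤ.≤-trans (cop-speed P) far)
      trails : ∀ i → cs (P +ℕ i) ≤ᶻ greedy-walk G (t +ℕ P) r i
      trails = greedy-walk-dominates G (t +ℕ P) r (λ i → cs (P +ℕ i)) (walk-shift G t P cs cop-walk) cop-start
      within : suc u +ℕ j ≤ k
      within = ℕ.≤-pred (subst (suc (suc u) +ℕ j ≤_) P+j≡k+1
                 (ℕ.+-monoˡ-≤ j (ℕ.≤-<-trans u<l (below-P (g j)))))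

    cop-behind : ∀ k → cs (suc k) <ᶻ g k
    cop-behind k with suc (suc k) ≤? P
    ... | yes k+1<P = behind-early k k+1<P
    ... | no k+1≮P = behind-late (suc k ∸ P) k (ℕ.m+[n∸m]≡n (ℕ.≤-pred (ℕ.≰⇒> k+1≮P)))

  escape : Evasion G t c r
  escape = record
    { walk   = g
    ; starts = refl
    ; apart  = ℤ.<⇒≢ c<r
    ; legal  = greedy-walk-legal G t r
    ; evades = λ cs legal-cop k →
        ℤ.<⇒≢ (cop-behind cs legal-cop k) ,
        ℤ.<⇒≢ (ℤ.<-≤-trans (cop-behind cs legal-cop k) (greedy-walk-monotone G t r (ℕ.n≤1+n k)))
    }

-- Reflecting the path v ↦ -v: the edge {i, i+1} of the reflection is the
-- edge {-i-1, -i} of G.  It lets the escape to the left reuse the one above.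
reflect : EPPath → EPPath
reflect G = record
  { len     = λ i → len G (- i - 1ℤ)
  ; len-nz  = λ i → len-nz G (- i - 1ℤ)
  ; pat     = λ i → pat G (- i - 1ℤ)
  ; has-one = λ i → has-one G (- i - 1ℤ)
  }

reflect-index : ∀ u → - - (u + 1ℤ) - 1ℤ ≡ u
reflect-index = solve-∀

unreflect-index : ∀ u → - u - 1ℤ ≡ - (u + 1ℤ)
unreflect-index = solve-∀

negate-succ : ∀ u → - u ≡ - (u + 1ℤ) + 1ℤ
negate-succ = solve-∀

negate-difference : ∀ c r → - c - - r ≡ - (c - r)
negate-difference = solve-∀

cancel-difference : ∀ c r → c + (r - c) ≡ r
cancel-difference = solve-∀

reflect-edge : ∀ G s u → Present G u s → Present (reflect G) (- (u + 1ℤ)) s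
reflect-edge G s u = subst (λ e → Present G e s) (sym (reflect-index u))

unreflect-edge : ∀ G s u → Present (reflect G) u s → Present G (- (u + 1ℤ)) s
unreflect-edge G s u = subst (λ e → Present G e s) (unreflect-index u)

move-reflect : ∀ G s u v → Move G s u v → Move (reflect G) s (- u) (- v)
move-reflect G s u v (inj₁ refl) = inj₁ refl
move-reflect G s u v (inj₂ (inj₁ (refl , present))) = inj₂ (inj₂ (negate-succ u , reflect-edge G s u present))
move-reflect G s u v (inj₂ (inj₂ (refl , present))) = inj₂ (inj₁ (negate-succ v , reflect-edge G s v present))

move-unreflect : ∀ G s u v → Move (reflect G) s u v → Move G s (- u) (- v)
move-unreflect G s u v (inj₁ refl) = inj₁ refl
move-unreflect G s u v (inj₂ (inj₁ (refl , present))) = inj₂ (inj₂ (negate-succ u , unreflect-edge G s u present))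
move-unreflect G s u v (inj₂ (inj₂ (refl , present))) = inj₂ (inj₁ (negate-succ v , unreflect-edge G s v present))

evasion-unreflect : ∀ G t c r → Evasion (reflect G) t (- c) (- r) → Evasion G t c r
evasion-unreflect G t c r e = record
  { walk   = λ k → - walk k
  ; starts = trans (cong -_ starts) (ℤ.neg-involutive r)
  ; apart  = λ c≡r → apart (cong -_ c≡r)
  ; legal  = λ k → move-unreflect G _ _ _ (legal k)
  ; evades = λ cs legal-cop k →
      let avoid = evades (λ i → - cs i) (reflected cs legal-cop) k
      in unnegate (proj₁ avoid) , unnegate (proj₂ avoid)
  }
  where
  open Evasion e
  reflected : ∀ cs → LegalCop G t c cs → LegalCop (reflect G) t (- c) (λ i → - cs i)
  reflected cs (cs0≡c , cop-walk) = cong -_ cs0≡c , λ k → move-reflect G _ _ _ (cop-walk k)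
  unnegate : ∀ {x y} → - x ≢ y → x ≢ - y
  unnegate {x} {y} -x≢y x≡-y = -x≢y (trans (cong -_ x≡-y) (ℤ.neg-involutive y))

dist-reflect : ∀ c r → dist (- c) (- r) ≡ dist c r
dist-reflect c r = trans (cong ∣_∣ (negate-difference c r)) (ℤ.∣-i∣≡∣i∣ (c - r))

far-right : ∀ {P} c r → c ≤ᶻ r → P ≤ dist c r → c + + P ≤ᶻ r
far-right {P} c r c≤r P≤d = begin
  c + + P         ≤⟨ ℤ.+-monoʳ-≤ c (subst (+ P ≤ᶻ_) (ℤ.∣-∣-≤ c≤r) (+≤+ P≤d)) ⟩
  c + (r - c)     ≡⟨ cancel-difference c r ⟩
  r               ∎
  where open ℤ.≤-Reasoning

robber-escapes : (G : EPPath) (P : ℕ) → (∀ i → len G i ∣ P) → (∀ i → len G i < P) →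
                 (t : ℕ) (c r : ℤ) → P ≤ dist c r → RobberWins G t c r
robber-escapes G P divides-P below-P t c r P≤d = evasion-wins G t c r evasion
  where
  evasion : Evasion G t c r
  evasion with ℤ.≤-total c r
  ... | inj₁ c≤r = EscapeRight.escape G P divides-P below-P t c r (far-right c r c≤r P≤d)
  ... | inj₂ r≤c = evasion-unreflect G t c r
        (EscapeRight.escape (reflect G) P (λ i → divides-P _) (λ i → below-P _) t (- c) (- r)
          (far-right (- c) (- r) (ℤ.neg-mono-≤ r≤c) (subst (P ≤_) (sym (dist-reflect c r)) P≤d)))

lemma12 : (G : EPPath) → FiniteLengths G →
          (lcm : ℕ) → IsLCMOf G lcm → (mx : ℕ) → IsMaxOf G mx →
          (t : ℕ) (c r : ℤ) →
          ((lcm ≡ mx → 2 * lcm ≤ dist c r → RobberWins G t c r)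
           × (lcm ≢ mx → lcm ≤ dist c r → RobberWins G t c r))
lemma12 G _ lcm (divides-lcm , lcm>0 , _) mx (below-mx , (i₀ , len-i₀≡mx)) t c r =
  (λ _ → robber-escapes G (2 * lcm) (λ i → ∣-trans (divides-lcm i) (n∣m*n 2)) below-2lcm t c r) ,
  (λ lcm≢mx → robber-escapes G lcm divides-lcm (below-lcm lcm≢mx) t c r)
  where
  instance
    lcm-nz : NonZero lcm
    lcm-nz = >-nonZero lcm>0
  ≤lcm : ∀ i → len G i ≤ lcm
  ≤lcm i = ∣⇒≤ (divides-lcm i)
  below-2lcm : ∀ i → len G i < 2 * lcm
  below-2lcm i = ℕ.≤-<-trans (≤lcm i) (subst (lcm <_) (ℕ.*-comm lcm 2) (ℕ.m<m*n lcm 2 ℕ.≤-refl))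
  -- a period equal to the LCM would make the LCM the maximum
  below-lcm : lcm ≢ mx → ∀ i → len G i < lcm
  below-lcm lcm≢mx i = ℕ.≤∧≢⇒< (≤lcm i) λ len≡lcm →
    lcm≢mx (ℕ.≤-antisym (subst (_≤ mx) len≡lcm (below-mx i)) (subst (_≤ lcm) len-i₀≡mx (≤lcm i₀)))
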